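{- Let $G$ be a finite group and $H$ a subgroup of index $2$. Let $S_1\subset G\setminus H$ and $h'\in H$, and set $S_2=S_1h'=\{sh': s\in S_1\}$. Then the pair graphs $\mathcal{G}(G,H,S_1)$ and $\mathcal{G}(G,H,S_2)$ are isomorphic.
   Context: The group-subgroup pair graph $\mathcal{G}(G,H,S)$ (for $S\subset G\setminus H$) is the undirected graph with vertex set $G$ whose edges are exactly the pairs $\{h,hs\}$ with $h\in H$, $s\in S$. -}

module Defs where

open import Level using (Level; _⊔_)
open import Algebra.Bundles using (Group)
open import Data.Nat using (ℕ)
open import Data.Fin using (Fin)
open import Data.Product using (Σ; ∃; _×_; _,_)
open import Data.Sum using (_⊎_)
open import Relation.Nullary using (¬_)

module _ {c ℓ : Level} (G : Group c ℓ) where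
  open Group G

  IsFiniteGroup : Set (c ⊔ ℓ)
  IsFiniteGroup = Σ ℕ λ n → Σ (Fin n → Carrier) λ enum →
                  ∀ x → ∃ λ i → enum i ≈ x

  RespectsEq : {p : Level} → (Carrier → Set p) → Set (c ⊔ ℓ ⊔ p)
  RespectsEq P = ∀ {x y} → x ≈ y → P x → P y

  record IsSubgroup {p : Level} (H : Carrier → Set p) : Set (c ⊔ ℓ ⊔ p) where
    field
      resp  : RespectsEq H
      has-ε : H ε
      ∙-closed : ∀ {x y} → H x → H y → H (x ∙ y)
      ⁻¹-closed : ∀ {x} → H x → H (x ⁻¹)

  -- H has index 2 in G: there are exactly two left cosets, H and gH with g ∉ H,
  -- i.e. some g ∉ H such that every x lies in H or in gH (g⁻¹x ∈ H).
  HasIndexTwo : {p : Level} → (Carrier → Set p) → Set (c ⊔ p)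
  HasIndexTwo H = Σ Carrier λ g → ¬ H g × (∀ x → H x ⊎ H (g ⁻¹ ∙ x))

  PairAdj : {p q : Level} → (Carrier → Set p) → (Carrier → Set q) →
            Carrier → Carrier → Set (c ⊔ ℓ ⊔ p ⊔ q)
  PairAdj H S x y = Σ Carrier λ h → Σ Carrier λ s → H h × S s ×
                    ((x ≈ h × y ≈ h ∙ s) ⊎ (y ≈ h × x ≈ h ∙ s))

  RightTranslate : {q : Level} → (Carrier → Set q) → Carrier → Carrier → Set (c ⊔ ℓ ⊔ q)
  RightTranslate S h' x = Σ Carrier λ s → S s × x ≈ s ∙ h'

  record GraphIso {a b : Level} (E₁ : Carrier → Carrier → Set a)
                  (E₂ : Carrier → Carrier → Set b) : Set (c ⊔ ℓ ⊔ a ⊔ b) where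
    field
      to       : Carrier → Carrier
      from     : Carrier → Carrier
      to-cong  : ∀ {x y} → x ≈ y → to x ≈ to y
      from-cong : ∀ {x y} → x ≈ y → from x ≈ from y
      to-from  : ∀ x → to (from x) ≈ x
      from-to  : ∀ x → from (to x) ≈ x
      preserve : ∀ x y → E₁ x y → E₂ (to x) (to y)
      reflect  : ∀ x y → E₂ (to x) (to y) → E₁ x y

-- Every edge {h, hs} of a pair graph joins H to G ∖ H, because s ∉ H. The
-- map fixing H pointwise and multiplying G ∖ H on the right by h' is therefore
-- a bijection of G (with inverse the same map for h'⁻¹) sending the edge
-- {h, hs} to {h, h(sh')}. Finiteness plays no role, and index two is used only
-- to decide membership in H.
module Submission where

open import Defs
open import Level using (Level; _⊔_)
open import Algebra.Bundles using (Group)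
open import Data.Product using (_×_; _,_)
open import Data.Sum using (inj₁; inj₂; [_,_]′)
open import Relation.Nullary using (¬_; Dec; yes; no; contradiction)
open import Relation.Nullary.Decidable using (toSum; decidable-stable)
import Algebra.Properties.Group as GroupProperties
import Algebra.Properties.Monoid as MonoidProperties
import Relation.Binary.Reasoning.Setoid as SetoidReasoning

module SubgroupProperties {c ℓ p : Level} (G : Group c ℓ)
    {H : Group.Carrier G → Set p} (H-sub : IsSubgroup G H) where
  open Group G
  open IsSubgroup H-sub
  open GroupProperties G using (⁻¹-involutive)
  open MonoidProperties monoid using (cancelˡ; cancelʳ)

  ∈-cancelˡ : ∀ {a b} → H a → H (a ∙ b) → H b
  ∈-cancelˡ {a} a∈H ab∈H =
    resp (cancelˡ (inverseˡ a) _) (∙-closed (⁻¹-closed a∈H) ab∈H)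

  ∈-cancelʳ : ∀ {a b} → H b → H (a ∙ b) → H a
  ∈-cancelʳ {b = b} b∈H ab∈H =
    resp (cancelʳ (inverseʳ b) _) (∙-closed ab∈H (⁻¹-closed b∈H))

  ∉-∙ˡ : ∀ {h x} → H h → ¬ H x → ¬ H (h ∙ x)
  ∉-∙ˡ h∈H x∉H hx∈H = x∉H (∈-cancelˡ h∈H hx∈H)

  ∉-∙ʳ : ∀ {x k} → H k → ¬ H x → ¬ H (x ∙ k)
  ∉-∙ʳ k∈H x∉H xk∈H = x∉H (∈-cancelʳ k∈H xk∈H)

  indexTwo⇒dec : HasIndexTwo G H → ∀ x → Dec (H x)
  indexTwo⇒dec (g , g∉H , covers) x with covers x
  ... | inj₁ x∈H = yes x∈H
  ... | inj₂ g⁻¹x∈H =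
    no λ x∈H → g∉H (resp (⁻¹-involutive g) (⁻¹-closed (∈-cancelʳ x∈H g⁻¹x∈H)))

module ShiftOutside {c ℓ p : Level} (G : Group c ℓ)
    {H : Group.Carrier G → Set p} (H-sub : IsSubgroup G H)
    (H? : ∀ x → Dec (H x)) where
  open Group G
  open IsSubgroup H-sub
  open SubgroupProperties G H-sub
  open MonoidProperties monoid using (cancelʳ)

  shiftOutside : Carrier → Carrier → Carrier
  shiftOutside k x with H? x
  ... | yes _ = x
  ... | no _ = x ∙ k

  shift-∈ : ∀ {k x} → H x → shiftOutside k x ≈ x
  shift-∈ {x = x} x∈H with H? x
  ... | yes _ = refl
  ... | no x∉H = contradiction x∈H x∉H

  shift-∉ : ∀ {k x} → ¬ H x → shiftOutside k x ≈ x ∙ k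
  shift-∉ {x = x} x∉H with H? x
  ... | yes x∈H = contradiction x∈H x∉H
  ... | no _ = refl

  shift-cong : ∀ {k x y} → x ≈ y → shiftOutside k x ≈ shiftOutside k y
  shift-cong {k} {x} {y} x≈y = [ inside , outside ]′ (toSum (H? x))
    where
    inside : H x → shiftOutside k x ≈ shiftOutside k y
    inside x∈H = trans (shift-∈ x∈H) (trans x≈y (sym (shift-∈ (resp x≈y x∈H))))
    outside : ¬ H x → shiftOutside k x ≈ shiftOutside k y
    outside x∉H = trans (shift-∉ x∉H)
      (trans (∙-congʳ x≈y) (sym (shift-∉ λ y∈H → x∉H (resp (sym x≈y) y∈H))))

  ∈-shift⁺ : ∀ {k x} → H x → H (shiftOutside k x)
  ∈-shift⁺ x∈H = resp (sym (shift-∈ x∈H)) x∈H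

  module _ {k : Carrier} (k∈H : H k) where

    ∉-shift⁺ : ∀ {x} → ¬ H x → ¬ H (shiftOutside k x)
    ∉-shift⁺ x∉H x'∈H = ∉-∙ʳ k∈H x∉H (resp (shift-∉ x∉H) x'∈H)

    ∈-shift⁻ : ∀ {x} → H (shiftOutside k x) → H x
    ∈-shift⁻ {x} x'∈H = decidable-stable (H? x) (λ x∉H → ∉-shift⁺ x∉H x'∈H)

    shift-inverse : ∀ {l} → k ∙ l ≈ ε → ∀ x → shiftOutside l (shiftOutside k x) ≈ x
    shift-inverse {l} kl≈ε x = [ inside , outside ]′ (toSum (H? x))
      where
      inside : H x → shiftOutside l (shiftOutside k x) ≈ x
      inside x∈H = trans (shift-∈ (∈-shift⁺ x∈H)) (shift-∈ x∈H)
      outside : ¬ H x → shiftOutside l (shiftOutside k x) ≈ x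
      outside x∉H = trans (shift-∉ (∉-shift⁺ x∉H))
        (trans (∙-congʳ (shift-∉ x∉H)) (cancelʳ kl≈ε x))

module PairGraphIso {c ℓ p q : Level} (G : Group c ℓ)
    {H : Group.Carrier G → Set p} (H-sub : IsSubgroup G H)
    (H? : ∀ x → Dec (H x))
    (S : Group.Carrier G → Set q) (S∩H≡∅ : ∀ s → S s → ¬ H s)
    (k : Group.Carrier G) (k∈H : H k) where
  open Group G
  open IsSubgroup H-sub using (resp; ⁻¹-closed)
  open GroupProperties G using (∙-cancelʳ)
  open SubgroupProperties G H-sub
  open ShiftOutside G H-sub H?
  open SetoidReasoning setoid

  shift : Carrier → Carrier
  shift = shiftOutside k

  arc-preserve : ∀ {x y h s} → H h → S s → x ≈ h → y ≈ h ∙ s →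
                 shift x ≈ h × shift y ≈ h ∙ (s ∙ k)
  arc-preserve {x} {y} {h} {s} h∈H s∈S x≈h y≈hs =
    trans (shift-∈ x∈H) x≈h , trans (shift-∉ y∉H) (trans (∙-congʳ y≈hs) (assoc h s k))
    where
    x∈H : H x
    x∈H = resp (sym x≈h) h∈H
    y∉H : ¬ H y
    y∉H y∈H = ∉-∙ˡ h∈H (S∩H≡∅ s s∈S) (resp y≈hs y∈H)

  arc-reflect : ∀ {x y h s t} → H h → S s → t ≈ s ∙ k →
                shift x ≈ h → shift y ≈ h ∙ t → x ≈ h × y ≈ h ∙ s
  arc-reflect {x} {y} {h} {s} {t} h∈H s∈S t≈sk x'≈h y'≈ht =
    trans (sym (shift-∈ x∈H)) x'≈h , ∙-cancelʳ k y (h ∙ s) yk≈hsk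
    where
    x∈H : H x
    x∈H = ∈-shift⁻ k∈H (resp (sym x'≈h) h∈H)
    ht∉H : ¬ H (h ∙ t)
    ht∉H ht∈H = ∉-∙ʳ k∈H (S∩H≡∅ s s∈S)
      (∈-cancelˡ h∈H (resp (∙-congˡ t≈sk) ht∈H))
    y∉H : ¬ H y
    y∉H y∈H = ht∉H (resp y'≈ht (∈-shift⁺ y∈H))
    yk≈hsk : y ∙ k ≈ (h ∙ s) ∙ k
    yk≈hsk = begin
      y ∙ k        ≈⟨ shift-∉ y∉H ⟨
      shift y      ≈⟨ y'≈ht ⟩
      h ∙ t        ≈⟨ ∙-congˡ t≈sk ⟩
      h ∙ (s ∙ k)  ≈⟨ assoc h s k ⟨
      (h ∙ s) ∙ k  ∎

  E₁ E₂ : Carrier → Carrier → Set (c ⊔ ℓ ⊔ p ⊔ q)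
  E₁ = PairAdj G H S
  E₂ = PairAdj G H (RightTranslate G S k)

  preserve : ∀ x y → E₁ x y → E₂ (shift x) (shift y)
  preserve x y (h , s , h∈H , s∈S , inj₁ (x≈h , y≈hs)) =
    h , s ∙ k , h∈H , (s , s∈S , refl) , inj₁ (arc-preserve h∈H s∈S x≈h y≈hs)
  preserve x y (h , s , h∈H , s∈S , inj₂ (y≈h , x≈hs)) =
    h , s ∙ k , h∈H , (s , s∈S , refl) , inj₂ (arc-preserve h∈H s∈S y≈h x≈hs)

  reflect : ∀ x y → E₂ (shift x) (shift y) → E₁ x y
  reflect x y (h , t , h∈H , (s , s∈S , t≈sk) , inj₁ (x'≈h , y'≈ht)) =
    h , s , h∈H , s∈S , inj₁ (arc-reflect h∈H s∈S t≈sk x'≈h y'≈ht)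
  reflect x y (h , t , h∈H , (s , s∈S , t≈sk) , inj₂ (y'≈h , x'≈ht)) =
    h , s , h∈H , s∈S , inj₂ (arc-reflect h∈H s∈S t≈sk y'≈h x'≈ht)

  rightTranslate-iso : GraphIso G E₁ E₂
  rightTranslate-iso = record
    { to        = shift
    ; from      = shiftOutside (k ⁻¹)
    ; to-cong   = shift-cong
    ; from-cong = shift-cong
    ; to-from   = shift-inverse (⁻¹-closed k∈H) (inverseˡ k)
    ; from-to   = shift-inverse k∈H (inverseʳ k)
    ; preserve  = preserve
    ; reflect   = reflect
    }

proposition4p2 : {c ℓ p q : Level} (G : Group c ℓ) →
    IsFiniteGroup G →
    (H : Group.Carrier G → Set p) → IsSubgroup G H → HasIndexTwo G H →
    (S₁ : Group.Carrier G → Set q) → RespectsEq G S₁ →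
    (∀ s → S₁ s → ¬ H s) →
    (h' : Group.Carrier G) → H h' →
    GraphIso G (PairAdj G H S₁) (PairAdj G H (RightTranslate G S₁ h'))
proposition4p2 G _ H H-sub index-two S₁ _ S₁∩H≡∅ h' h'∈H =
  PairGraphIso.rightTranslate-iso G H-sub (SubgroupProperties.indexTwo⇒dec G H-sub index-two)
    S₁ S₁∩H≡∅ h' h'∈H
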